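{- Suppose $0<1/n\ll\tau\ll\mu\ll\eta\ll1$. Let $G$ be an $n$-vertex oriented graph satisfying $\sigma_2(G)\ge(1+\eta)n$. For any vertex subset $X\subseteq V(G)$ with $|X|\le 8\sqrt{\mu}\,n$ there exists a set of vertices $\mathcal{R}\subseteq V(G)\setminus X$ of size at most $2^{ -6}\tau n$ with the following property: for every $S\subseteq\mathcal{R}$ with $|S|\le 2^{ -11}\tau^2n$ and for every pair of non-adjacent vertices $u$ and $v$ in $V(G)\setminus\mathcal{R}$, there exists a $(u,v)$-path with one internal vertex, which lies in $\mathcal{R}\setminus S$.
   Context: An oriented graph is a loopless digraph with at most one edge between any two vertices; $d(x)$ is the total degree; vertices are non-adjacent if no edge joins them in either direction; $\sigma_2(G)=\min\{d(x)+d(y):x,y\text{ non-adjacent}\}$. A $(u,v)$-path with one internal vertex $w$ is a sequence $u\,w\,v$ where $u,w$ and $w,v$ are each joined by an edge of $G$ in some direction (oriented path, directions arbitrary). Hierarchy convention: "$a\ll b$" means the statement holds whenever $a\le f(b)$ for some non-decreasing function $f$; constants are chosen from right to left. -}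

module Defs where

open import Data.Nat using (ℕ; zero; suc)
open import Data.Bool using (Bool; true; false; _∨_; if_then_else_)
open import Data.Fin using (Fin)
open import Data.List using (List; map; allFin)
open import Data.Nat.ListAction using (sum)
open import Data.Integer using (+_)
open import Data.Rational using (ℚ; _/_)
open import Relation.Binary.PropositionalEquality using (_≡_)

-- A digraph on vertex set Fin n: E x y ≡ true means there is an edge x → y.
Digraph : ℕ → Set
Digraph n = Fin n → Fin n → Bool

record IsOriented {n : ℕ} (E : Digraph n) : Set where
  field
    loopless : ∀ x → E x x ≡ false
    antisym  : ∀ x y → E x y ≡ true → E y x ≡ false

adj : ∀ {n} → Digraph n → Fin n → Fin n → Bool
adj E x y = E x y ∨ E y x

-- total degree d(x) = out-degree + in-degree
-- (in an oriented graph this is the number of vertices adjacent to x).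
outdeg : ∀ {n} → Digraph n → Fin n → ℕ
outdeg {n} E x = sum (map (λ y → if E x y then 1 else 0) (allFin n))

indeg : ∀ {n} → Digraph n → Fin n → ℕ
indeg {n} E x = sum (map (λ y → if E y x then 1 else 0) (allFin n))

deg : ∀ {n} → Digraph n → Fin n → ℕ
deg E x = outdeg E x Data.Nat.+ indeg E x

toℚ : ℕ → ℚ
toℚ k = + k / 1

{-# OPTIONS --safe #-}
module Submission where

-- Write η ≥ 1/a with a the denominator of η. For non-adjacent u ≠ v, d(u) + d(v) ≥ (1 + 1/a)n and
-- |N(u) ∪ N(v)| ≤ n give at least n/a common neighbours, and once μ ≤ 1/256a² at least n/2a of them
-- lie outside X. It therefore suffices to find R of size r ≈ τn/64 outside X meeting each of these n²
-- candidate sets in more than k ≈ τ²n/2048 vertices: no admissible S can then cover R ∩ N(u) ∩ N(v).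
-- Instead of sampling R at random we derandomise greedily with the potential Σ_{u,v} 2^(r − |R ∩ C(u,v)|):
-- as every candidate set keeps at least g ≈ n/4a unused vertices, the best next vertex multiplies the
-- potential by at most 1 − g/2n. After r steps the potential is at most n² 2ʳ (1 − g/2n)ʳ, which by
-- Bernoulli's inequality is below 2^(r − k) for large n, so every candidate set is hit more than k times.

module Counting where

  open import Data.Nat hiding (_≟_)
  open import Data.Nat.Properties hiding (_≟_)
  open import Data.Bool using (Bool; true; false; _∧_; _∨_; not)
  open import Data.Fin using (Fin; zero; suc)
  open import Data.Fin.Properties using (_≟_)
  open import Data.Product using (∃; _×_; _,_; map)
  open import Function using (_∘_; id)
  open import Relation.Binary.PropositionalEquality
  open import Relation.Nullary using (does; yes; no)
  open import Data.Bool.Properties using (∨-identityʳ; ∧-identityʳ)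
  open import Data.List using (allFin)
  import Data.List.Relation.Unary.All as All
  open import Data.List.Membership.Propositional.Properties using (∈-allFin)
  open import Data.List.Extrema.Nat using (argmax; f[xs]≤f[argmax])
  open import Algebra.Properties.Semiring.Sum +-*-semiring public
    using (sum; sum-syntax; sum-cong-≗; ∑-distrib-+; ∑-comm; *-distribˡ-sum)

  ⟦_⟧ : Bool → ℕ
  ⟦ true ⟧  = 1
  ⟦ false ⟧ = 0

  count : ∀ {n} → (Fin n → Bool) → ℕ
  count {n} p = ∑[ i < n ] ⟦ p i ⟧

  ∑-mono-≤ : ∀ {n} {f g : Fin n → ℕ} → (∀ i → f i ≤ g i) → sum f ≤ sum g
  ∑-mono-≤ {zero}  f≤g = z≤n
  ∑-mono-≤ {suc n} f≤g = +-mono-≤ (f≤g zero) (∑-mono-≤ (f≤g ∘ suc))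

  ∑-const : ∀ n c → ∑[ i < n ] c ≡ n * c
  ∑-const zero    c = refl
  ∑-const (suc n) c = cong (c +_) (∑-const n c)

  f[i]≤∑f : ∀ {n} (f : Fin n → ℕ) i → f i ≤ sum f
  f[i]≤∑f f zero    = m≤m+n _ _
  f[i]≤∑f f (suc i) = ≤-trans (f[i]≤∑f (f ∘ suc) i) (m≤n+m _ _)

  ∑-δ : ∀ {n} (f : Fin n → ℕ) w → ∑[ i < n ] (⟦ does (i ≟ w) ⟧ * f i) ≡ f w
  ∑-δ {suc n} f zero    = begin
    f zero + 0 + ∑[ i < n ] 0 ≡⟨ cong₂ _+_ (+-identityʳ (f zero)) (∑-const n 0) ⟩
    f zero + n * 0            ≡⟨ cong (f zero +_) (*-zeroʳ n) ⟩
    f zero + 0                ≡⟨ +-identityʳ (f zero) ⟩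
    f zero                    ∎
    where open ≡-Reasoning
  ∑-δ {suc n} f (suc w) = ∑-δ (λ i → f (suc i)) w

  ⟦⟧≤1 : ∀ b → ⟦ b ⟧ ≤ 1
  ⟦⟧≤1 true  = ≤-refl
  ⟦⟧≤1 false = z≤n

  count≤n : ∀ {n} (p : Fin n → Bool) → count p ≤ n
  count≤n {n} p = ≤-trans (∑-mono-≤ (⟦⟧≤1 ∘ p)) (≤-reflexive (trans (∑-const n 1) (*-identityʳ n)))

  count-false : ∀ {n} {p : Fin n → Bool} → (∀ i → p i ≡ false) → count p ≡ 0
  count-false {n} p≡false = trans (sum-cong-≗ (cong ⟦_⟧ ∘ p≡false)) (trans (∑-const n 0) (*-zeroʳ n))

  count-mono : ∀ {n} {p q : Fin n → Bool} → (∀ i → p i ≡ true → q i ≡ true) → count p ≤ count q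
  count-mono {p = p} {q} p⊆q = ∑-mono-≤ pointwise
    where
    pointwise : ∀ i → ⟦ p i ⟧ ≤ ⟦ q i ⟧
    pointwise i with p i in pᵢ
    ... | false = z≤n
    ... | true rewrite p⊆q i pᵢ = ≤-refl

  count-∨-∧ : ∀ {n} (p q : Fin n → Bool) →
    count p + count q ≡ count (λ i → p i ∨ q i) + count (λ i → p i ∧ q i)
  count-∨-∧ {n} p q = begin
    count p + count q                              ≡⟨ ∑-distrib-+ (⟦_⟧ ∘ p) (⟦_⟧ ∘ q) ⟨
    ∑[ i < n ] (⟦ p i ⟧ + ⟦ q i ⟧)                 ≡⟨ sum-cong-≗ (λ i → pointwise (p i) (q i)) ⟩
    ∑[ i < n ] (⟦ p i ∨ q i ⟧ + ⟦ p i ∧ q i ⟧)     ≡⟨ ∑-distrib-+ (λ i → ⟦ p i ∨ q i ⟧) (λ i → ⟦ p i ∧ q i ⟧) ⟩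
    count (λ i → p i ∨ q i) + count (λ i → p i ∧ q i) ∎
    where
    open ≡-Reasoning
    pointwise : ∀ x y → ⟦ x ⟧ + ⟦ y ⟧ ≡ ⟦ x ∨ y ⟧ + ⟦ x ∧ y ⟧
    pointwise true  true  = refl
    pointwise true  false = refl
    pointwise false y     = sym (+-identityʳ ⟦ y ⟧)

  count-<⇒∃ : ∀ {n} (p q : Fin n → Bool) → count p < count q → ∃ λ i → q i ≡ true × p i ≡ false
  count-<⇒∃ {suc n} p q p<q with q zero in q₀ | p zero in p₀
  ... | true  | false = zero , q₀ , p₀
  ... | true  | true  = map suc id (count-<⇒∃ (λ i → p (suc i)) (λ i → q (suc i)) (s≤s⁻¹ p<q))
  ... | false | true  = map suc id (count-<⇒∃ (λ i → p (suc i)) (λ i → q (suc i)) (≤-trans (n≤1+n _) p<q))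
  ... | false | false = map suc id (count-<⇒∃ (λ i → p (suc i)) (λ i → q (suc i)) p<q)

  count-∖ : ∀ {n} (p q : Fin n → Bool) → count p ≤ count (λ i → p i ∧ not (q i)) + count q
  count-∖ {n} p q = begin
    count p                                      ≤⟨ ∑-mono-≤ (λ i → pointwise (p i) (q i)) ⟩
    ∑[ i < n ] (⟦ p i ∧ not (q i) ⟧ + ⟦ q i ⟧)   ≡⟨ ∑-distrib-+ (λ i → ⟦ p i ∧ not (q i) ⟧) (⟦_⟧ ∘ q) ⟩
    count (λ i → p i ∧ not (q i)) + count q      ∎
    where
    open ≤-Reasoning
    pointwise : ∀ x y → ⟦ x ⟧ ≤ ⟦ x ∧ not y ⟧ + ⟦ y ⟧
    pointwise true  true  = ≤-refl
    pointwise true  false = ≤-refl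
    pointwise false y     = z≤n

  insert : ∀ {n} → Fin n → (Fin n → Bool) → Fin n → Bool
  insert w R x = R x ∨ does (x ≟ w)

  count-insert-∧ : ∀ {n} (R c : Fin n → Bool) {w} → R w ≡ false →
    count (λ x → insert w R x ∧ c x) ≡ count (λ x → R x ∧ c x) + ⟦ c w ⟧
  count-insert-∧ {n} R c {w} w∉R = begin
    count (λ x → insert w R x ∧ c x)
      ≡⟨ sum-cong-≗ pointwise ⟩
    ∑[ x < n ] (⟦ R x ∧ c x ⟧ + ⟦ does (x ≟ w) ⟧ * ⟦ c x ⟧)
      ≡⟨ ∑-distrib-+ (λ x → ⟦ R x ∧ c x ⟧) (λ x → ⟦ does (x ≟ w) ⟧ * ⟦ c x ⟧) ⟩
    count (λ x → R x ∧ c x) + ∑[ x < n ] (⟦ does (x ≟ w) ⟧ * ⟦ c x ⟧)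
      ≡⟨ cong (count (λ x → R x ∧ c x) +_) (∑-δ (⟦_⟧ ∘ c) w) ⟩
    count (λ x → R x ∧ c x) + ⟦ c w ⟧ ∎
    where
    open ≡-Reasoning
    pointwise : ∀ x → ⟦ insert w R x ∧ c x ⟧ ≡ ⟦ R x ∧ c x ⟧ + ⟦ does (x ≟ w) ⟧ * ⟦ c x ⟧
    pointwise x with x ≟ w
    ... | yes refl rewrite w∉R = sym (+-identityʳ ⟦ c x ⟧)
    ... | no _     rewrite ∨-identityʳ (R x) = sym (+-identityʳ ⟦ R x ∧ c x ⟧)

  count-insert : ∀ {n} (R : Fin n → Bool) {w} → R w ≡ false → count (insert w R) ≡ suc (count R)
  count-insert R {w} w∉R = begin
    count (insert w R)                    ≡⟨ sum-cong-≗ (λ x → cong ⟦_⟧ (∧-identityʳ (insert w R x))) ⟨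
    count (λ x → insert w R x ∧ true)     ≡⟨ count-insert-∧ R (λ _ → true) w∉R ⟩
    count (λ x → R x ∧ true) + 1          ≡⟨ cong (_+ 1) (sum-cong-≗ (λ x → cong ⟦_⟧ (∧-identityʳ (R x)))) ⟩
    count R + 1                           ≡⟨ +-comm (count R) 1 ⟩
    suc (count R)                         ∎
    where open ≡-Reasoning

  ∑-incidence : ∀ {m n} (a : Fin n → Bool) (C : Fin m → Fin n → Bool) (f : Fin m → ℕ) →
    ∑[ w < n ] (⟦ a w ⟧ * ∑[ i < m ] (⟦ C i w ⟧ * f i)) ≡ ∑[ i < m ] (f i * count (λ w → a w ∧ C i w))
  ∑-incidence {m} {n} a C f = begin
    ∑[ w < n ] (⟦ a w ⟧ * ∑[ i < m ] (⟦ C i w ⟧ * f i))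
      ≡⟨ sum-cong-≗ (λ w → *-distribˡ-sum ⟦ a w ⟧ (λ i → ⟦ C i w ⟧ * f i)) ⟩
    ∑[ w < n ] ∑[ i < m ] (⟦ a w ⟧ * (⟦ C i w ⟧ * f i))
      ≡⟨ ∑-comm (λ w i → ⟦ a w ⟧ * (⟦ C i w ⟧ * f i)) ⟩
    ∑[ i < m ] ∑[ w < n ] (⟦ a w ⟧ * (⟦ C i w ⟧ * f i))
      ≡⟨ sum-cong-≗ (λ i → sum-cong-≗ (λ w → pointwise (a w) (C i w) (f i))) ⟩
    ∑[ i < m ] ∑[ w < n ] (f i * ⟦ a w ∧ C i w ⟧)
      ≡⟨ sum-cong-≗ (λ i → *-distribˡ-sum (f i) (λ w → ⟦ a w ∧ C i w ⟧)) ⟨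
    ∑[ i < m ] (f i * count (λ w → a w ∧ C i w)) ∎
    where
    open ≡-Reasoning
    pointwise : ∀ x y z → ⟦ x ⟧ * (⟦ y ⟧ * z) ≡ z * ⟦ x ∧ y ⟧
    pointwise true  true  z = trans (*-identityˡ (1 * z)) (trans (*-identityˡ z) (sym (*-identityʳ z)))
    pointwise true  false z = sym (*-zeroʳ z)
    pointwise false y     z = sym (*-zeroʳ z)

  ∃-maximiser : ∀ {n} (a : Fin n → Bool) (f : Fin n → ℕ) {w₀} → a w₀ ≡ true →
    ∃ λ w → a w ≡ true × (∀ x → a x ≡ true → f x ≤ f w)
  ∃-maximiser {n} a f {w₀} a[w₀] = w , a[w] , maximal
    where
    -- The suc makes every point of a beat every point outside a.
    F : Fin n → ℕ
    F x = ⟦ a x ⟧ * suc (f x)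
    w : Fin n
    w = argmax F w₀ (allFin n)
    F≤F[w] : ∀ x → F x ≤ F w
    F≤F[w] x = All.lookup (f[xs]≤f[argmax] w₀ (allFin n)) (∈-allFin x)
    a[w] : a w ≡ true
    a[w] with a w | F≤F[w] w₀
    ... | true  | _ = refl
    ... | false | F[w₀]≤0 rewrite a[w₀] with () ← F[w₀]≤0
    maximal : ∀ x → a x ≡ true → f x ≤ f w
    maximal x a[x] with F≤F[w] x
    ... | Fx≤Fw rewrite a[x] | a[w] = s≤s⁻¹ (subst₂ _≤_ (+-identityʳ _) (+-identityʳ _) Fx≤Fw)

  ∑≤n*max : ∀ {n} (a : Fin n → Bool) (f : Fin n → ℕ) {w} → (∀ x → a x ≡ true → f x ≤ f w) →
    ∑[ x < n ] (⟦ a x ⟧ * f x) ≤ n * f w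
  ∑≤n*max {n} a f {w} maximal = ≤-trans (∑-mono-≤ pointwise) (≤-reflexive (∑-const n (f w)))
    where
    pointwise : ∀ x → ⟦ a x ⟧ * f x ≤ f w
    pointwise x with a x in a[x]
    ... | true  = ≤-trans (≤-reflexive (+-identityʳ (f x))) (maximal x a[x])
    ... | false = z≤n

  [1+a]n≤a[|p|+|q|]⇒n≤a|p∩q| : ∀ {n} a (p q : Fin n → Bool) →
    suc a * n ≤ a * (count p + count q) → n ≤ a * count (λ i → p i ∧ q i)
  [1+a]n≤a[|p|+|q|]⇒n≤a|p∩q| {n} a p q bound = +-cancelˡ-≤ (a * n) n _ (begin
    a * n + n                               ≡⟨ +-comm (a * n) n ⟩
    suc a * n                               ≤⟨ bound ⟩
    a * (count p + count q)                 ≡⟨ cong (a *_) (count-∨-∧ p q) ⟩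
    a * (count p∪q + count p∩q)             ≤⟨ *-monoʳ-≤ a (+-monoˡ-≤ (count p∩q) (count≤n p∪q)) ⟩
    a * (n + count p∩q)                     ≡⟨ *-distribˡ-+ a n (count p∩q) ⟩
    a * n + a * count p∩q                   ∎)
    where
    open ≤-Reasoning
    p∪q p∩q : Fin n → Bool
    p∪q i = p i ∨ q i
    p∩q i = p i ∧ q i

module SubsetCount where

  open import Data.Nat using (suc)
  open import Data.Bool using (Bool; true; false)
  open import Data.Fin using (Fin)
  open import Data.Fin.Subset using (Subset; _∈_; _∉_; ∣_∣)
  open import Data.Vec using ([]; _∷_; lookup; tabulate)
  open import Data.Vec.Properties using (lookup∘tabulate; []=⇒lookup; lookup⇒[]=)
  open import Function using (_∘_)
  open import Relation.Binary.PropositionalEquality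
  open Counting

  ∣p∣≡count : ∀ {n} (p : Subset n) → ∣ p ∣ ≡ count (lookup p)
  ∣p∣≡count []          = refl
  ∣p∣≡count (true ∷ p)  = cong suc (∣p∣≡count p)
  ∣p∣≡count (false ∷ p) = ∣p∣≡count p

  ∣tabulate∣≡count : ∀ {n} (p : Fin n → Bool) → ∣ tabulate p ∣ ≡ count p
  ∣tabulate∣≡count p = trans (∣p∣≡count (tabulate p)) (sum-cong-≗ (cong ⟦_⟧ ∘ lookup∘tabulate p))

  ∈-tabulate⁺ : ∀ {n} {p : Fin n → Bool} {x} → p x ≡ true → x ∈ tabulate p
  ∈-tabulate⁺ {p = p} {x} p[x] = lookup⇒[]= x (tabulate p) (trans (lookup∘tabulate p x) p[x])

  ∈-tabulate⁻ : ∀ {n} {p : Fin n → Bool} {x} → x ∈ tabulate p → p x ≡ true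
  ∈-tabulate⁻ {p = p} {x} x∈p = trans (sym (lookup∘tabulate p x)) ([]=⇒lookup x∈p)

  lookup≡false⇒∉ : ∀ {n} {p : Subset n} {x} → lookup p x ≡ false → x ∉ p
  lookup≡false⇒∉ p[x]≡false x∈p with () ← trans (sym ([]=⇒lookup x∈p)) p[x]≡false

module HittingSet where

  open import Data.Nat hiding (_≟_)
  open import Data.Nat.Properties hiding (_≟_)
  open import Data.Bool using (Bool; true; false; _∧_; not)
  open import Data.Bool.Properties using (∧-conicalˡ; ∧-conicalʳ; not-injective)
  open import Data.Fin using (Fin)
  open import Data.Fin.Properties using (_≟_)
  open import Data.Product using (∃; _×_; _,_; proj₁; proj₂)
  open import Relation.Binary.PropositionalEquality
  open import Relation.Nullary using (yes)
  open import Data.Nat.Tactic.RingSolver using (solve-∀)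
  open Counting

  m∸n≡1+[m∸1+n] : ∀ {m n} → n < m → m ∸ n ≡ suc (m ∸ suc n)
  m∸n≡1+[m∸1+n] = +-∸-assoc 1

  module Greedy {n m : ℕ} (D : Fin n → Bool) (C : Fin m → Fin n → Bool)
    (C⊆D : ∀ i w → C i w ≡ true → D w ≡ true) (g r : ℕ)
    (C-large : ∀ i → g + r ≤ count (C i)) (D-large : r ≤ count D) where

    hits : (Fin n → Bool) → Fin m → ℕ
    hits R i = count (λ w → R w ∧ C i w)

    weight : (Fin n → Bool) → Fin m → ℕ
    weight R i = 2 ^ (r ∸ hits R i)

    potential : (Fin n → Bool) → ℕ
    potential R = ∑[ i < m ] weight R i

    gain : (Fin n → Bool) → Fin n → ℕ
    gain R w = ∑[ i < m ] (⟦ C i w ⟧ * weight R i)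

    ∅ : Fin n → Bool
    ∅ _ = false

    count-∅ : count ∅ ≡ 0
    count-∅ = count-false {n} (λ _ → refl)

    potential-∅ : potential ∅ ≡ m * 2 ^ r
    potential-∅ = trans (sum-cong-≗ {m} (λ i → cong (λ h → 2 ^ (r ∸ h)) count-∅)) (∑-const m (2 ^ r))

    weight-halving : ∀ h b → h < r → 2 * 2 ^ (r ∸ (h + ⟦ b ⟧)) + ⟦ b ⟧ * 2 ^ (r ∸ h) ≡ 2 * 2 ^ (r ∸ h)
    weight-halving h false _ rewrite +-identityʳ h = +-identityʳ _
    weight-halving h true h<r rewrite +-comm h 1 | m∸n≡1+[m∸1+n] h<r = double (2 ^ (r ∸ suc h))
      where
      double : ∀ x → 2 * x + 1 * (2 * x) ≡ 2 * (2 * x)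
      double = solve-∀

    potential-insert : ∀ R {w} → R w ≡ false → (∀ i → hits R i < r) →
      2 * potential (insert w R) + gain R w ≡ 2 * potential R
    potential-insert R {w} w∉R hits<r = begin
      2 * potential (insert w R) + gain R w
        ≡⟨ cong (_+ gain R w) (*-distribˡ-sum 2 (weight (insert w R))) ⟩
      ∑[ i < m ] (2 * weight (insert w R) i) + gain R w
        ≡⟨ ∑-distrib-+ (λ i → 2 * weight (insert w R) i) (λ i → ⟦ C i w ⟧ * weight R i) ⟨
      ∑[ i < m ] (2 * weight (insert w R) i + ⟦ C i w ⟧ * weight R i)
        ≡⟨ sum-cong-≗ halve ⟩
      ∑[ i < m ] (2 * weight R i)
        ≡⟨ *-distribˡ-sum 2 (weight R) ⟨
      2 * potential R ∎
      where
      open ≡-Reasoning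
      halve : ∀ i → 2 * weight (insert w R) i + ⟦ C i w ⟧ * weight R i ≡ 2 * weight R i
      halve i rewrite count-insert-∧ R (C i) w∉R = weight-halving (hits R i) (C i w) (hits<r i)

    record Stage (t : ℕ) : Set where
      field
        chosen  : Fin n → Bool
        ⊆D      : ∀ w → chosen w ≡ true → D w ≡ true
        size    : count chosen ≡ t
        decay   : (2 * n) ^ t * potential chosen ≤ (2 * n ∸ g) ^ t * potential ∅

    module Step {t} (t<r : t < r) (stage : Stage t) where

      open Stage stage renaming (chosen to R)

      available : Fin n → Bool
      available w = D w ∧ not (R w)

      hits<r : ∀ i → hits R i < r
      hits<r i = ≤-<-trans (≤-trans (count-mono (λ w → ∧-conicalˡ (R w) (C i w))) (≤-reflexive size)) t<r

      available-in-C : ∀ i → g ≤ count (λ w → available w ∧ C i w)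
      available-in-C i = +-cancelʳ-≤ t g _ (begin
        g + t                                         ≤⟨ +-monoʳ-≤ g (<⇒≤ t<r) ⟩
        g + r                                         ≤⟨ C-large i ⟩
        count (C i)                                   ≤⟨ count-∖ (C i) R ⟩
        count (λ w → C i w ∧ not (R w)) + count R     ≤⟨ +-mono-≤ (count-mono pointwise) (≤-reflexive size) ⟩
        count (λ w → available w ∧ C i w) + t         ∎)
        where
        open ≤-Reasoning
        pointwise : ∀ w → C i w ∧ not (R w) ≡ true → available w ∧ C i w ≡ true
        pointwise w C∖R with C i w in c | R w
        ... | true | false rewrite C⊆D i w c = refl

      averaging : g * potential R ≤ ∑[ w < n ] (⟦ available w ⟧ * gain R w)
      averaging = begin
        g * potential R                                          ≡⟨ *-distribˡ-sum g (weight R) ⟩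
        ∑[ i < m ] (g * weight R i)                              ≤⟨ ∑-mono-≤ (λ i → ≤-trans (≤-reflexive (*-comm g (weight R i)))
                                                                       (*-monoʳ-≤ (weight R i) (available-in-C i))) ⟩
        ∑[ i < m ] (weight R i * count (λ w → available w ∧ C i w)) ≡⟨ ∑-incidence available C (weight R) ⟨
        ∑[ w < n ] (⟦ available w ⟧ * gain R w)                  ∎
        where open ≤-Reasoning

      some-available : ∃ λ w → available w ≡ true
      some-available with count-<⇒∃ R D (≤-trans (s≤s (≤-reflexive size)) (≤-trans t<r D-large))
      ... | w , D[w] , R[w] = w , cong₂ (λ d x → d ∧ not x) D[w] R[w]

      best : ∃ λ w → available w ≡ true × (∀ x → available x ≡ true → gain R x ≤ gain R w)
      best = ∃-maximiser available (gain R) (proj₂ some-available)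

      w : Fin n
      w = proj₁ best

      available[w] : available w ≡ true
      available[w] = proj₁ (proj₂ best)

      R[w] : R w ≡ false
      R[w] = not-injective (∧-conicalʳ (D w) (not (R w)) available[w])

      one-step : 2 * n * potential (insert w R) ≤ (2 * n ∸ g) * potential R
      one-step = begin
        2 * n * potential (insert w R)                        ≡⟨ m+n∸n≡m _ (g * potential R) ⟨
        2 * n * potential (insert w R) + g * potential R ∸ g * potential R
          ≤⟨ ∸-monoˡ-≤ (g * potential R) key ⟩
        2 * n * potential R ∸ g * potential R                ≡⟨ *-distribʳ-∸ (potential R) (2 * n) g ⟨
        (2 * n ∸ g) * potential R                            ∎
        where
        open ≤-Reasoning
        rearrange : ∀ n x y → 2 * n * x + n * y ≡ n * (2 * x + y)
        rearrange = solve-∀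
        key : 2 * n * potential (insert w R) + g * potential R ≤ 2 * n * potential R
        key = begin
          2 * n * potential (insert w R) + g * potential R
            ≤⟨ +-monoʳ-≤ _ (≤-trans averaging (∑≤n*max available (gain R) (proj₂ (proj₂ best)))) ⟩
          2 * n * potential (insert w R) + n * gain R w      ≡⟨ rearrange n _ _ ⟩
          n * (2 * potential (insert w R) + gain R w)        ≡⟨ cong (n *_) (potential-insert R R[w] hits<r) ⟩
          n * (2 * potential R)                              ≡⟨ *-assoc n 2 _ ⟨
          n * 2 * potential R                                ≡⟨ cong (_* potential R) (*-comm n 2) ⟩
          2 * n * potential R                                ∎

      next : Stage (suc t)
      next = record
        { chosen = insert w R
        ; ⊆D     = insert-⊆D
        ; size   = trans (count-insert R R[w]) (cong suc size)
        ; decay  = begin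
          (2 * n) ^ suc t * potential (insert w R)         ≡⟨ regroup ((2 * n) ^ t) (2 * n) _ ⟩
          (2 * n) ^ t * (2 * n * potential (insert w R))   ≤⟨ *-monoʳ-≤ ((2 * n) ^ t) one-step ⟩
          (2 * n) ^ t * ((2 * n ∸ g) * potential R)        ≡⟨ swap ((2 * n) ^ t) (2 * n ∸ g) _ ⟩
          (2 * n ∸ g) * ((2 * n) ^ t * potential R)        ≤⟨ *-monoʳ-≤ (2 * n ∸ g) decay ⟩
          (2 * n ∸ g) * ((2 * n ∸ g) ^ t * potential ∅)    ≡⟨ *-assoc (2 * n ∸ g) _ (potential ∅) ⟨
          (2 * n ∸ g) ^ suc t * potential ∅                ∎
        }
        where
        open ≤-Reasoning
        regroup : ∀ a b c → b * a * c ≡ a * (b * c)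
        regroup = solve-∀
        swap : ∀ a b c → a * (b * c) ≡ b * (a * c)
        swap = solve-∀
        insert-⊆D : ∀ x → insert w R x ≡ true → D x ≡ true
        insert-⊆D x inserted with R x in R[x] | x ≟ w
        ... | true  | _        = ⊆D x R[x]
        ... | false | yes refl = D[w]
          where D[w] = ∧-conicalˡ (D w) (not (R w)) available[w]

    stage : ∀ t → t ≤ r → Stage t
    stage zero    _   = record { chosen = ∅ ; ⊆D = λ _ () ; size = count-∅ ; decay = ≤-refl }
    stage (suc t) t<r = Step.next t<r (stage t (<⇒≤ t<r))

    hitting-set : ∀ k → (2 * n ∸ g) ^ r * (m * 2 ^ k) < (2 * n) ^ r →
      ∃ λ R → (∀ w → R w ≡ true → D w ≡ true) × count R ≡ r × (∀ i → k < hits R i)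
    hitting-set k gap = chosen , ⊆D , size , λ i → ≰⇒> (λ hits≤k → <⇒≱ gap (few-hits⇒no-gap i hits≤k))
      where
      open Stage (stage r ≤-refl)
      few-hits⇒no-gap : ∀ i → hits chosen i ≤ k → (2 * n) ^ r ≤ (2 * n ∸ g) ^ r * (m * 2 ^ k)
      few-hits⇒no-gap i hits≤k = *-cancelʳ-≤ _ _ (2 ^ (r ∸ k)) {{m^n≢0 2 (r ∸ k)}} (begin
        (2 * n) ^ r * 2 ^ (r ∸ k)                   ≤⟨ *-monoʳ-≤ ((2 * n) ^ r) (^-monoʳ-≤ 2 (∸-monoʳ-≤ r hits≤k)) ⟩
        (2 * n) ^ r * weight chosen i               ≤⟨ *-monoʳ-≤ ((2 * n) ^ r) (f[i]≤∑f (weight chosen) i) ⟩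
        (2 * n) ^ r * potential chosen              ≤⟨ decay ⟩
        (2 * n ∸ g) ^ r * potential ∅               ≡⟨ cong ((2 * n ∸ g) ^ r *_) potential-∅ ⟩
        (2 * n ∸ g) ^ r * (m * 2 ^ r)               ≤⟨ *-monoʳ-≤ ((2 * n ∸ g) ^ r) (*-monoʳ-≤ m 2^r≤2^k*2^[r∸k]) ⟩
        (2 * n ∸ g) ^ r * (m * (2 ^ k * 2 ^ (r ∸ k))) ≡⟨ regroup ((2 * n ∸ g) ^ r) m (2 ^ k) (2 ^ (r ∸ k)) ⟩
        (2 * n ∸ g) ^ r * (m * 2 ^ k) * 2 ^ (r ∸ k) ∎)
        where
        open ≤-Reasoning
        2^r≤2^k*2^[r∸k] : 2 ^ r ≤ 2 ^ k * 2 ^ (r ∸ k)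
        2^r≤2^k*2^[r∸k] = ≤-trans (^-monoʳ-≤ 2 (m≤n+m∸n r k)) (≤-reflexive (^-distribˡ-+-* 2 k (r ∸ k)))
        regroup : ∀ a b c d → a * (b * (c * d)) ≡ a * (b * c) * d
        regroup = solve-∀

module Growth where

  open import Data.Nat
  open import Data.Nat.Properties
  open import Data.Product using (∃; _,_)
  open import Relation.Binary.PropositionalEquality
  open import Data.Nat.Tactic.RingSolver using (solve-∀)

  bernoulli : ∀ z g M → z ^ M * (z + M * g) ≤ (z + g) ^ M * z
  bernoulli z g zero = ≤-reflexive (identity z g)
    where
    identity : ∀ z g → 1 * (z + 0 * g) ≡ 1 * z
    identity = solve-∀
  bernoulli z g (suc M) = begin
    z ^ suc M * (z + suc M * g)                       ≤⟨ m≤m+n _ _ ⟩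
    z ^ suc M * (z + suc M * g) + z ^ M * M * g * g   ≡⟨ expand z g M (z ^ M) ⟩
    (z + g) * (z ^ M * (z + M * g))                   ≤⟨ *-monoʳ-≤ (z + g) (bernoulli z g M) ⟩
    (z + g) * ((z + g) ^ M * z)                       ≡⟨ *-assoc (z + g) _ z ⟨
    (z + g) ^ suc M * z                               ∎
    where
    open ≤-Reasoning
    expand : ∀ z g M P → z * P * (z + suc M * g) + P * M * g * g ≡ (z + g) * (P * (z + M * g))
    expand = solve-∀

  2*z^M≤[z+g]^M : ∀ {z g M} → 0 < z → z ≤ M * g → 2 * z ^ M ≤ (z + g) ^ M
  2*z^M≤[z+g]^M {z@(suc _)} {g} {M} _ z≤Mg = *-cancelʳ-≤ _ _ z (begin
    2 * z ^ M * z       ≡⟨ regroup (z ^ M) z ⟩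
    z ^ M * (z + z)     ≤⟨ *-monoʳ-≤ (z ^ M) (+-monoʳ-≤ z z≤Mg) ⟩
    z ^ M * (z + M * g) ≤⟨ bernoulli z g M ⟩
    (z + g) ^ M * z     ∎)
    where
    open ≤-Reasoning
    regroup : ∀ P z → 2 * P * z ≡ P * (z + z)
    regroup = solve-∀

  2^j*z^[jM]≤[z+g]^[jM] : ∀ {z g M} j → 0 < z → z ≤ M * g → 2 ^ j * z ^ (j * M) ≤ (z + g) ^ (j * M)
  2^j*z^[jM]≤[z+g]^[jM] zero    _   _    = ≤-refl
  2^j*z^[jM]≤[z+g]^[jM] {z} {g} {M} (suc j) z>0 z≤Mg = begin
    2 * 2 ^ j * z ^ (M + j * M)           ≡⟨ cong (2 * 2 ^ j *_) (^-distribˡ-+-* z M (j * M)) ⟩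
    2 * 2 ^ j * (z ^ M * z ^ (j * M))     ≡⟨ regroup (2 ^ j) (z ^ M) (z ^ (j * M)) ⟩
    (2 * z ^ M) * (2 ^ j * z ^ (j * M))   ≤⟨ *-mono-≤ (2*z^M≤[z+g]^M {z} {g} {M} z>0 z≤Mg) (2^j*z^[jM]≤[z+g]^[jM] {z} {g} {M} j z>0 z≤Mg) ⟩
    (z + g) ^ M * (z + g) ^ (j * M)       ≡⟨ ^-distribˡ-+-* (z + g) M (j * M) ⟨
    (z + g) ^ (M + j * M)                 ∎
    where
    open ≤-Reasoning
    regroup : ∀ A B C → 2 * A * (B * C) ≡ (2 * B) * (A * C)
    regroup = solve-∀

  z^r*N<[z+g]^r : ∀ {z g M j r N} → 0 < z → z ≤ M * g → j * M ≤ r → N < 2 ^ j → z ^ r * N < (z + g) ^ r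
  z^r*N<[z+g]^r {z@(suc _)} {g} {M} {j} {r} {N} z>0 z≤Mg jM≤r N<2^j = begin-strict
    z ^ r * N                                   <⟨ *-monoʳ-< (z ^ r) {{m^n≢0 z r}} N<2^j ⟩
    z ^ r * 2 ^ j                               ≡⟨ cong (λ e → z ^ e * 2 ^ j) (m+[n∸m]≡n jM≤r) ⟨
    z ^ (j * M + s) * 2 ^ j                     ≡⟨ cong (_* 2 ^ j) (^-distribˡ-+-* z (j * M) s) ⟩
    z ^ (j * M) * z ^ s * 2 ^ j                 ≡⟨ regroup (z ^ (j * M)) (z ^ s) (2 ^ j) ⟩
    (2 ^ j * z ^ (j * M)) * z ^ s               ≤⟨ *-mono-≤ (2^j*z^[jM]≤[z+g]^[jM] {z} {g} {M} j z>0 z≤Mg) (^-monoˡ-≤ s (m≤m+n z g)) ⟩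
    (z + g) ^ (j * M) * (z + g) ^ s             ≡⟨ ^-distribˡ-+-* (z + g) (j * M) s ⟨
    (z + g) ^ (j * M + s)                       ≡⟨ cong ((z + g) ^_) (m+[n∸m]≡n jM≤r) ⟩
    (z + g) ^ r                                 ∎
    where
    open ≤-Reasoning
    s = r ∸ j * M
    regroup : ∀ A B C → A * B * C ≡ C * A * B
    regroup = solve-∀

  m*m≤n*n⇒m≤n : ∀ {m n} → m * m ≤ n * n → m ≤ n
  m*m≤n*n⇒m≤n m²≤n² = ≮⇒≥ (λ n<m → <⇒≱ (*-mono-< n<m n<m) m²≤n²)

  [4+d]²≤2^[4+d] : ∀ d → (4 + d) * (4 + d) ≤ 2 ^ (4 + d)
  [4+d]²≤2^[4+d] zero    = ≤-refl
  [4+d]²≤2^[4+d] (suc d) = begin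
    (5 + d) * (5 + d)                           ≤⟨ m≤m+n _ _ ⟩
    (5 + d) * (5 + d) + (7 + 6 * d + d * d)     ≡⟨ expand d ⟩
    2 * ((4 + d) * (4 + d))                     ≤⟨ *-monoʳ-≤ 2 ([4+d]²≤2^[4+d] d) ⟩
    2 ^ (5 + d)                                 ∎
    where
    open ≤-Reasoning
    expand : ∀ d → (5 + d) * (5 + d) + (7 + 6 * d + d * d) ≡ 2 * ((4 + d) * (4 + d))
    expand = solve-∀

  exp-beats-square : ∀ L → ∃ λ e₀ → ∀ e → e₀ ≤ e → (L * suc e) * (L * suc e) < 2 ^ e
  exp-beats-square L = s + s , beyond
    where
    s = 4 + 3 * L
    sq : ℕ → ℕ
    sq x = x * x
    base : sq (L * suc (s + s)) < 2 ^ (s + s)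
    base = begin-strict
      sq (L * suc (s + s))   ≤⟨ *-mono-≤ L[2s+1]≤L*3s L[2s+1]≤L*3s ⟩
      sq (L * (3 * s))       ≡⟨ regroup L s ⟩
      sq (3 * L) * sq s      <⟨ *-monoˡ-< (sq s) (*-mono-< 3L<s 3L<s) ⟩
      sq s * sq s            ≤⟨ *-mono-≤ ([4+d]²≤2^[4+d] (3 * L)) ([4+d]²≤2^[4+d] (3 * L)) ⟩
      2 ^ s * 2 ^ s          ≡⟨ ^-distribˡ-+-* 2 s s ⟨
      2 ^ (s + s)            ∎
      where
      open ≤-Reasoning
      3L<s : 3 * L < s
      3L<s = m≤n+m (suc (3 * L)) 3
      L[2s+1]≤L*3s : L * suc (s + s) ≤ L * (3 * s)
      L[2s+1]≤L*3s = *-monoʳ-≤ L (begin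
        suc (s + s)   ≡⟨ +-comm 1 (s + s) ⟩
        s + s + 1     ≤⟨ +-monoʳ-≤ (s + s) (s≤s z≤n) ⟩
        s + s + s     ≡⟨ thrice s ⟩
        3 * s         ∎)
        where
        thrice : ∀ s → s + s + s ≡ 3 * s
        thrice = solve-∀
      regroup : ∀ a b → (a * (3 * b)) * (a * (3 * b)) ≡ ((3 * a) * (3 * a)) * (b * b)
      regroup = solve-∀
    doubling : ∀ c → sq (L * suc (suc (2 + c))) ≤ 2 * sq (L * suc (2 + c))
    doubling c = ≤-trans (m≤m+n _ (L * L * (2 + 4 * c + c * c))) (≤-reflexive (expand L c))
      where
      expand : ∀ L c → (L * (4 + c)) * (L * (4 + c)) + L * L * (2 + 4 * c + c * c) ≡ 2 * ((L * (3 + c)) * (L * (3 + c)))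
      expand = solve-∀
    beyond : ∀ e → s + s ≤ e → sq (L * suc e) < 2 ^ e
    beyond e s+s≤e with e ∸ (s + s) | m+[n∸m]≡n s+s≤e
    ... | d | refl = from-base d
      where
      from-base : ∀ d → sq (L * suc (s + s + d)) < 2 ^ (s + s + d)
      from-base zero    = subst (λ e → sq (L * suc e) < 2 ^ e) (sym (+-identityʳ (s + s))) base
      from-base (suc d) = subst (λ e → sq (L * suc e) < 2 ^ e) (sym (+-suc (s + s) d)) (begin-strict
        sq (L * suc (suc (s + s + d)))   ≤⟨ doubling _ ⟩
        2 * sq (L * suc (s + s + d))     <⟨ *-monoʳ-< 2 (from-base d) ⟩
        2 * 2 ^ (s + s + d)              ∎)
        where open ≤-Reasoning

module Fractions where

  open import Data.Nat as ℕ using (ℕ; zero; suc; _+_; _*_; _≤_)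
  import Data.Nat.Properties as ℕ
  open import Data.Integer as ℤ using (+_; -[1+_])
  import Data.Integer.Properties as ℤ
  open import Data.Rational as ℚ using (ℚ; mkℚ; 0ℚ; 1ℚ; toℚᵘ)
  import Data.Rational.Properties as ℚ
  open import Data.Rational.Unnormalised as ℚᵘ using (mkℚᵘ; *≤*)
  import Data.Rational.Unnormalised.Properties as ℚᵘ
  open import Data.Product using (∃; _,_)
  open import Relation.Binary.PropositionalEquality
  open import Data.Nat.Tactic.RingSolver using (solve-∀)
  open import Defs using (toℚ)
  open Growth using (m*m≤n*n⇒m≤n)

  infix 4 _≃_/1+_

  -- Denominators are stored minus one, as in ℚᵘ, so that the products and cross-multiplications
  -- below reduce definitionally to expressions in suc b.
  _≃_/1+_ : ℚ → ℕ → ℕ → Set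
  p ≃ A /1+ b = toℚᵘ p ℚᵘ.≃ mkℚᵘ (+ A) b

  toℚ-≃ : ∀ k → toℚ k ≃ k /1+ 0
  toℚ-≃ k = ℚ.toℚᵘ-fromℚᵘ (mkℚᵘ (+ k) 0)

  1ℚ-≃ : 1ℚ ≃ 1 /1+ 0
  1ℚ-≃ = ℚᵘ.≃-refl

  1/1+-≃ : ∀ b → + 1 ℚ./ suc b ≃ 1 /1+ b
  1/1+-≃ b = ℚ.toℚᵘ-fromℚᵘ (mkℚᵘ (+ 1) b)

  0<1/ : ∀ d .{{_ : ℕ.NonZero d}} → 0ℚ ℚ.< + 1 ℚ./ d
  0<1/ (suc b) = ℚ.toℚᵘ-cancel-< (ℚᵘ.<-respʳ-≃ (ℚᵘ.≃-sym (1/1+-≃ b)) (ℚᵘ.*<* (ℤ.+<+ (ℕ.s≤s ℕ.z≤n))))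

  positive-≃ : ∀ p → 0ℚ ℚ.< p → ∃ λ P → p ≃ suc P /1+ ℚ.denominator-1 p
  positive-≃ (mkℚ (+ suc P) _ _) _ = P , ℚᵘ.≃-refl
  positive-≃ (mkℚ (+ zero) _ _)  (ℚ.*<* (ℤ.+<+ ()))
  positive-≃ (mkℚ -[1+ _ ] _ _)  (ℚ.*<* ())

  module _ {p q : ℚ} {A b C d : ℕ} where

    *-≃ : p ≃ A /1+ b → q ≃ C /1+ d → p ℚ.* q ≃ A * C /1+ (d + b * suc d)
    *-≃ p≃ q≃ = ℚᵘ.≃-trans (ℚ.toℚᵘ-homo-* p q) (ℚᵘ.≃-trans (ℚᵘ.*-cong p≃ q≃)
      (ℚᵘ.≃-reflexive (cong (λ z → mkℚᵘ z _) (sym (ℤ.pos-* A C)))))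

    +-≃ : p ≃ A /1+ b → q ≃ C /1+ d → p ℚ.+ q ≃ A * suc d + C * suc b /1+ (d + b * suc d)
    +-≃ p≃ q≃ = ℚᵘ.≃-trans (ℚ.toℚᵘ-homo-+ p q) (ℚᵘ.≃-trans (ℚᵘ.+-cong p≃ q≃)
      (ℚᵘ.≃-reflexive (cong (λ z → mkℚᵘ z _) (trans
        (cong₂ ℤ._+_ (sym (ℤ.pos-* A (suc d))) (sym (ℤ.pos-* C (suc b))))
        (sym (ℤ.pos-+ (A * suc d) (C * suc b)))))))

    ≤-≃⁻ : p ≃ A /1+ b → q ≃ C /1+ d → p ℚ.≤ q → A * suc d ≤ C * suc b
    ≤-≃⁻ p≃ q≃ p≤q with ℚᵘ.≤-respʳ-≃ q≃ (ℚᵘ.≤-respˡ-≃ p≃ (ℚ.toℚᵘ-mono-≤ p≤q))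
    ... | *≤* le = ℤ.drop‿+≤+ (subst₂ ℤ._≤_ (sym (ℤ.pos-* A (suc d))) (sym (ℤ.pos-* C (suc b))) le)

    ≤-≃⁺ : p ≃ A /1+ b → q ≃ C /1+ d → A * suc d ≤ C * suc b → p ℚ.≤ q
    ≤-≃⁺ p≃ q≃ le = ℚ.toℚᵘ-cancel-≤ (ℚᵘ.≤-respʳ-≃ (ℚᵘ.≃-sym q≃) (ℚᵘ.≤-respˡ-≃ (ℚᵘ.≃-sym p≃)
      (*≤* (subst₂ ℤ._≤_ (ℤ.pos-* A (suc d)) (ℤ.pos-* C (suc b)) (ℤ.+≤+ le)))))

  module _ {b P : ℕ} {η : ℚ} (η≃ : η ≃ suc P /1+ b) where

    [1+η]n≤d⇒[1+a]n≤ad : ∀ n d → (1ℚ ℚ.+ η) ℚ.* toℚ n ℚ.≤ toℚ d → suc (suc b) * n ≤ suc b * d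
    [1+η]n≤d⇒[1+a]n≤ad n d le = begin
      suc (suc b) * n                       ≤⟨ ℕ.m≤m+n _ (P * n) ⟩
      suc (suc b) * n + P * n               ≡⟨ expand b P n ⟩
      (1 * suc b + suc P * 1) * n * 1       ≤⟨ ≤-≃⁻ (*-≃ (+-≃ 1ℚ-≃ η≃) (toℚ-≃ n)) (toℚ-≃ d) le ⟩
      d * ((1 * suc b) * 1)                 ≡⟨ collect b d ⟩
      suc b * d                             ∎
      where
      open ℕ.≤-Reasoning
      expand : ∀ b P n → suc (suc b) * n + P * n ≡ (1 * suc b + suc P * 1) * n * 1
      expand = solve-∀
      collect : ∀ b d → d * ((1 * suc b) * 1) ≡ suc b * d
      collect = solve-∀

  module _ {b M e : ℕ} {μ : ℚ} (μ≃ : μ ≃ suc M /1+ e) (μ≤ : μ ℚ.≤ + 1 ℚ./ (256 * suc b * suc b)) where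

    x²≤64μn²⇒2ax≤n : ∀ x n → toℚ x ℚ.* toℚ x ℚ.≤ toℚ 64 ℚ.* μ ℚ.* (toℚ n ℚ.* toℚ n) → 2 * suc b * x ≤ n
    x²≤64μn²⇒2ax≤n x n le = m*m≤n*n⇒m≤n (ℕ.*-cancelʳ-≤ _ _ (64 * suc M) (begin
      (2 * a * x) * (2 * a * x) * (64 * suc M)        ≡⟨ regroup a x M ⟩
      (x * x) * (suc M * (256 * a * a))               ≤⟨ ℕ.*-monoʳ-≤ (x * x) (≤-≃⁻ μ≃ (1/1+-≃ _) μ≤) ⟩
      (x * x) * (1 * suc e)                           ≡⟨ pad x e ⟩
      (x * x) * ((1 * suc e) * (1 * 1))               ≤⟨ ≤-≃⁻ (*-≃ (toℚ-≃ x) (toℚ-≃ x))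
                                                            (*-≃ (*-≃ (toℚ-≃ 64) μ≃) (*-≃ (toℚ-≃ n) (toℚ-≃ n))) le ⟩
      (64 * suc M * (n * n)) * (1 * 1)                ≡⟨ unpad M n ⟩
      (n * n) * (64 * suc M)                          ∎))
      where
      open ℕ.≤-Reasoning
      a = suc b
      regroup : ∀ a x M → (2 * a * x) * (2 * a * x) * (64 * suc M) ≡ (x * x) * (suc M * (256 * a * a))
      regroup = solve-∀
      pad : ∀ x e → (x * x) * (1 * suc e) ≡ (x * x) * ((1 * suc e) * (1 * 1))
      pad = solve-∀
      unpad : ∀ M n → (64 * suc M * (n * n)) * (1 * 1) ≡ (n * n) * (64 * suc M)
      unpad = solve-∀

  module _ {T f : ℕ} {τ : ℚ} (τ≃ : τ ≃ suc T /1+ f) where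

    τ≤1/32a⇒32aT≤q : ∀ b → τ ℚ.≤ + 1 ℚ./ (32 * suc b) → 32 * suc b * suc T ≤ suc f
    τ≤1/32a⇒32aT≤q b τ≤ = begin
      32 * suc b * suc T                ≡⟨ ℕ.*-comm (32 * suc b) (suc T) ⟩
      suc T * (32 * suc b)              ≤⟨ ≤-≃⁻ τ≃ (1/1+-≃ _) τ≤ ⟩
      1 * suc f                         ≡⟨ ℕ.*-identityˡ (suc f) ⟩
      suc f                             ∎
      where open ℕ.≤-Reasoning

    64qr≤Tn⇒r≤τn/64 : ∀ r n → r * (64 * suc f) ≤ suc T * n → toℚ r ℚ.≤ (+ 1 ℚ./ 64) ℚ.* τ ℚ.* toℚ n
    64qr≤Tn⇒r≤τn/64 r n le = ≤-≃⁺ (toℚ-≃ r) (*-≃ (*-≃ (1/1+-≃ 63) τ≃) (toℚ-≃ n)) (begin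
      r * (64 * suc f * 1)        ≡⟨ cong (r *_) (ℕ.*-identityʳ (64 * suc f)) ⟩
      r * (64 * suc f)            ≤⟨ le ⟩
      suc T * n                   ≡⟨ pad T n ⟩
      1 * suc T * n * 1           ∎)
      where
      open ℕ.≤-Reasoning
      pad : ∀ T n → suc T * n ≡ 1 * suc T * n * 1
      pad = solve-∀

    s≤τ²n/2048⇒2048q²s≤T²n : ∀ s n → toℚ s ℚ.≤ (+ 1 ℚ./ 2048) ℚ.* (τ ℚ.* τ) ℚ.* toℚ n →
      s * (2048 * (suc f * suc f)) ≤ suc T * suc T * n
    s≤τ²n/2048⇒2048q²s≤T²n s n le = begin
      s * (2048 * (suc f * suc f))        ≡⟨ cong (s *_) (ℕ.*-identityʳ _) ⟨
      s * (2048 * (suc f * suc f) * 1)    ≤⟨ ≤-≃⁻ (toℚ-≃ s) (*-≃ (*-≃ (1/1+-≃ 2047) (*-≃ τ≃ τ≃)) (toℚ-≃ n)) le ⟩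
      1 * (suc T * suc T) * n * 1         ≡⟨ unpad T n ⟩
      suc T * suc T * n                   ∎
      where
      open ℕ.≤-Reasoning
      unpad : ∀ T n → 1 * (suc T * suc T) * n * 1 ≡ suc T * suc T * n
      unpad = solve-∀

module OrientedGraph where

  open import Data.Nat hiding (_≟_)
  open import Data.Nat.Properties hiding (_≟_)
  open import Data.Bool using (Bool; true; false; _∧_; if_then_else_)
  open import Data.Fin using (Fin; zero; suc)
  open import Data.List using (map; tabulate)
  open import Data.Nat.ListAction as List using ()
  open import Function using (_∘_)
  open import Relation.Binary.PropositionalEquality
  open import Defs
  open Counting

  sum-map-tabulate : ∀ {A : Set} {m} (f : A → ℕ) (h : Fin m → A) → List.sum (map f (tabulate h)) ≡ ∑[ i < m ] f (h i)
  sum-map-tabulate {m = zero}  f h = refl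
  sum-map-tabulate {m = suc m} f h = cong (f (h zero) +_) (sum-map-tabulate f (λ i → h (suc i)))

  if-then-1-else-0≡⟦⟧ : ∀ b → (if b then 1 else 0) ≡ ⟦ b ⟧
  if-then-1-else-0≡⟦⟧ true  = refl
  if-then-1-else-0≡⟦⟧ false = refl

  module _ {n : ℕ} (E : Digraph n) (oriented : IsOriented E) where

    deg≡count-adj : ∀ x → deg E x ≡ count (adj E x)
    deg≡count-adj x = begin
      deg E x                                               ≡⟨ cong₂ _+_ (in-sum (E x)) (in-sum (λ y → E y x)) ⟩
      count (E x) + count (λ y → E y x)                     ≡⟨ count-∨-∧ (E x) (λ y → E y x) ⟩
      count (adj E x) + count (λ y → E x y ∧ E y x)         ≡⟨ cong (count (adj E x) +_) (count-false no-2-cycle) ⟩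
      count (adj E x) + 0                                   ≡⟨ +-identityʳ _ ⟩
      count (adj E x)                                       ∎
      where
      open ≡-Reasoning
      in-sum : ∀ (p : Fin n → Bool) → List.sum (map (λ y → if p y then 1 else 0) (tabulate (λ y → y))) ≡ count p
      in-sum p = trans (sum-map-tabulate (λ y → if p y then 1 else 0) (λ y → y)) (sum-cong-≗ (if-then-1-else-0≡⟦⟧ ∘ p))
      no-2-cycle : ∀ y → (E x y ∧ E y x) ≡ false
      no-2-cycle y with E x y in e
      ... | true  = IsOriented.antisym oriented x y e
      ... | false = refl

    common-neighbours : ∀ a u v → suc a * n ≤ a * (deg E u + deg E v) → n ≤ a * count (λ w → adj E u w ∧ adj E v w)
    common-neighbours a u v bound = [1+a]n≤a[|p|+|q|]⇒n≤a|p∩q| a (adj E u) (adj E v)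
      (subst (λ d → suc a * n ≤ a * d) (cong₂ _+_ (deg≡count-adj u) (deg≡count-adj v)) bound)

module Reservoir where

  open import Data.Nat hiding (_≟_)
  open import Data.Nat.Properties hiding (_≟_)
  open import Data.Nat.DivMod using (_/_; _%_; m/n*n≤m; m≡m%n+[m/n]*n; m%n<n; m*n/n≡m; /-monoˡ-≤)
  open import Data.Bool using (Bool; true; false; _∧_; _∨_; not)
  open import Data.Bool.Properties using (∧-conicalˡ; ∧-conicalʳ; ∨-comm; not-injective)
  open import Data.Fin using (Fin; combine; remQuot; fromℕ<)
  open import Data.Fin.Properties using (_≟_; remQuot-combine)
  open import Data.Product using (Σ; ∃; _×_; _,_; proj₁; proj₂; uncurry)
  open import Relation.Binary.PropositionalEquality
  open import Relation.Nullary using (does; yes; no; ¬_; contradiction)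
  open import Data.Nat.Tactic.RingSolver using (solve-∀)
  open import Data.Fin.Subset using (Subset; _∈_; _∉_; ∣_∣)
  open import Data.Vec using (lookup; tabulate)
  open import Defs
  open Counting
  open SubsetCount
  open Growth
  open OrientedGraph

  m<[1+m/n]*n : ∀ m n .{{_ : NonZero n}} → m < suc (m / n) * n
  m<[1+m/n]*n m n = begin-strict
    m                   ≡⟨ m≡m%n+[m/n]*n m n ⟩
    m % n + m / n * n   <⟨ +-monoˡ-< (m / n * n) (m%n<n m n) ⟩
    n + m / n * n       ∎
    where open ≤-Reasoning

  m*n≤o⇒m≤o/n : ∀ m n o .{{_ : NonZero n}} → m * n ≤ o → m ≤ o / n
  m*n≤o⇒m≤o/n m n o mn≤o = subst (_≤ o / n) (m*n/n≡m m n) (/-monoˡ-≤ n mn≤o)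

  module Parameters (b T f : ℕ) (32aT≤q : 32 * suc b * suc T ≤ suc f) where

    a t q M L e₀ n₀ : ℕ
    a = suc b
    t = suc T
    q = suc f
    M = 16 * a
    L = 128 * q * M
    e₀ = proj₁ (exp-beats-square L)
    n₀ = suc (L * e₀ + 8 * a)

    module Sizes {n : ℕ} (n₀≤n : n₀ ≤ n) where

      -- r is the size of the reservoir, k bounds the admissible |S|, every candidate set keeps at least
      -- g unused vertices during the construction, and the r steps contain j blocks of M steps,
      -- each of which at least halves the potential.
      r k g j : ℕ
      r = t * n / (64 * q)
      k = t * t * n / (2048 * (q * q))
      g = n / (4 * a)
      j = r / M

      8a≤n : 8 * a ≤ n
      8a≤n = ≤-trans (m≤n+m (8 * a) (L * e₀)) (≤-trans (n≤1+n _) n₀≤n)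

      Le₀<n : L * e₀ < n
      Le₀<n = ≤-trans (s≤s (m≤m+n (L * e₀) (8 * a))) n₀≤n

      r*4a≤n : r * (4 * a) ≤ n
      r*4a≤n = ≤-trans (*-monoʳ-≤ r (*-monoˡ-≤ a (4≤2048))) (*-cancelʳ-≤ _ _ t (begin
        r * (2048 * a) * t        ≡⟨ regroup r a t ⟩
        64 * r * (32 * a * t)     ≤⟨ *-monoʳ-≤ (64 * r) 32aT≤q ⟩
        64 * r * q                ≡⟨ regroup′ r q ⟩
        t * n / (64 * q) * (64 * q) ≤⟨ m/n*n≤m (t * n) (64 * q) ⟩
        t * n                     ≡⟨ *-comm t n ⟩
        n * t                     ∎))
        where
        open ≤-Reasoning
        4≤2048 : 4 ≤ 2048
        4≤2048 = m≤m+n 4 2044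
        regroup : ∀ r a t → r * (2048 * a) * t ≡ 64 * r * (32 * a * t)
        regroup = solve-∀
        regroup′ : ∀ r q → 64 * r * q ≡ r * (64 * q)
        regroup′ = solve-∀

      g+r≤ : ∀ {c} → n ≤ 2 * a * c → g + r ≤ c
      g+r≤ {c} n≤2ac = *-cancelʳ-≤ _ _ (4 * a) (begin
        (g + r) * (4 * a)                ≡⟨ *-distribʳ-+ (4 * a) g r ⟩
        g * (4 * a) + r * (4 * a)        ≤⟨ +-mono-≤ (m/n*n≤m n (4 * a)) r*4a≤n ⟩
        n + n                            ≤⟨ +-mono-≤ n≤2ac n≤2ac ⟩
        2 * a * c + 2 * a * c            ≡⟨ regroup a c ⟩
        c * (4 * a)                      ∎)
        where
        open ≤-Reasoning
        regroup : ∀ a c → 2 * a * c + 2 * a * c ≡ c * (4 * a)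
        regroup = solve-∀

      2n≤Mg : 2 * n ≤ M * g
      2n≤Mg = +-cancelʳ-≤ (16 * a) (2 * n) (M * g) (begin
        2 * n + 16 * a                   ≤⟨ +-monoʳ-≤ (2 * n) (≤-trans (≤-reflexive (*-assoc 2 8 a)) (*-monoʳ-≤ 2 8a≤n)) ⟩
        2 * n + 2 * n                    ≡⟨ regroup n ⟩
        4 * n                            ≤⟨ *-monoʳ-≤ 4 (<⇒≤ (m<[1+m/n]*n n (4 * a))) ⟩
        4 * (suc g * (4 * a))            ≡⟨ regroup′ g a ⟩
        16 * a * g + 16 * a              ∎)
        where
        open ≤-Reasoning
        regroup : ∀ n → 2 * n + 2 * n ≡ 4 * n
        regroup = solve-∀
        regroup′ : ∀ g a → 4 * (suc g * (4 * a)) ≡ 16 * a * g + 16 * a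
        regroup′ = solve-∀

      g<2n : g < 2 * n
      g<2n = begin-strict
        g                 ≤⟨ m≤m*n g (4 * a) ⟩
        g * (4 * a)       ≤⟨ m/n*n≤m n (4 * a) ⟩
        n                 <⟨ m<m+n n (≤-trans (s≤s z≤n) 8a≤n) ⟩
        n + n             ≡⟨ cong (n +_) (+-identityʳ n) ⟨
        2 * n             ∎
        where open ≤-Reasoning

      64Mk≤r : 64 * M * k ≤ r
      64Mk≤r = s≤s⁻¹ (*-cancelʳ-< (q * (64 * q)) (64 * M * k) (suc r) (begin-strict
        64 * M * k * (q * (64 * q))            ≡⟨ regroup a k q ⟩
        k * (2048 * (q * q)) * (32 * a)        ≤⟨ *-monoˡ-≤ (32 * a) (m/n*n≤m (t * t * n) (2048 * (q * q))) ⟩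
        t * t * n * (32 * a)                   ≡⟨ regroup′ t n a ⟩
        t * n * (32 * a * t)                   ≤⟨ *-monoʳ-≤ (t * n) 32aT≤q ⟩
        t * n * q                              <⟨ *-monoˡ-< q (m<[1+m/n]*n (t * n) (64 * q)) ⟩
        suc r * (64 * q) * q                   ≡⟨ *-assoc (suc r) (64 * q) q ⟩
        suc r * (64 * q * q)                   ≡⟨ cong (suc r *_) (*-comm (64 * q) q) ⟩
        suc r * (q * (64 * q))                 ∎))
        where
        open ≤-Reasoning
        regroup : ∀ a k q → 64 * (16 * a) * k * (q * (64 * q)) ≡ k * (2048 * (q * q)) * (32 * a)
        regroup = solve-∀
        regroup′ : ∀ t n a → t * t * n * (32 * a) ≡ t * n * (32 * a * t)
        regroup′ = solve-∀

      jM≤r : j * M ≤ r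
      jM≤r = m/n*n≤m r M

      64k≤j : 64 * k ≤ j
      64k≤j = s≤s⁻¹ (*-cancelʳ-< M (64 * k) (suc j) (begin-strict
        64 * k * M     ≡⟨ trans (*-assoc 64 k M) (trans (cong (64 *_) (*-comm k M)) (sym (*-assoc 64 M k))) ⟩
        64 * M * k     ≤⟨ 64Mk≤r ⟩
        r              <⟨ m<[1+m/n]*n r M ⟩
        suc j * M      ∎))
        where open ≤-Reasoning

      e : ℕ
      e = j ∸ k

      k+e≡j : k + e ≡ j
      k+e≡j = m+[n∸m]≡n (≤-trans (m≤n*m k 64) 64k≤j)

      n≤L[1+e] : n ≤ L * suc e
      n≤L[1+e] = begin
        n                          ≤⟨ m≤n*m n t ⟩
        t * n                      ≤⟨ <⇒≤ (m<[1+m/n]*n (t * n) (64 * q)) ⟩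
        suc r * (64 * q)           ≤⟨ *-monoˡ-≤ (64 * q) (m<[1+m/n]*n r M) ⟩
        suc j * M * (64 * q)       ≤⟨ *-monoˡ-≤ (64 * q) (*-monoˡ-≤ M 1+j≤2[1+e]) ⟩
        2 * suc e * M * (64 * q)   ≡⟨ regroup e M q ⟩
        L * suc e                  ∎
        where
        open ≤-Reasoning
        k≤e : k ≤ e
        k≤e = +-cancelˡ-≤ k k e (begin
          k + k            ≤⟨ +-monoʳ-≤ k (m≤n*m k 63) ⟩
          k + 63 * k       ≤⟨ 64k≤j ⟩
          j                ≡⟨ k+e≡j ⟨
          k + e            ∎)
        1+j≤2[1+e] : suc j ≤ 2 * suc e
        1+j≤2[1+e] = begin
          suc j            ≡⟨ cong suc k+e≡j ⟨
          suc (k + e)      ≤⟨ s≤s (+-monoˡ-≤ e k≤e) ⟩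
          suc (e + e)      ≤⟨ n≤1+n _ ⟩
          suc (suc (e + e)) ≡⟨ double e ⟩
          2 * suc e        ∎
          where
          double : ∀ e → suc (suc (e + e)) ≡ 2 * suc e
          double = solve-∀
        regroup : ∀ e M q → 2 * suc e * M * (64 * q) ≡ 128 * q * M * suc e
        regroup = solve-∀

      e₀≤e : e₀ ≤ e
      e₀≤e = ≮⇒≥ (λ e<e₀ → <⇒≱ Le₀<n (≤-trans n≤L[1+e] (*-monoʳ-≤ L e<e₀)))

      n²2ᵏ<2ʲ : n * n * 2 ^ k < 2 ^ j
      n²2ᵏ<2ʲ = begin-strict
        n * n * 2 ^ k                        ≤⟨ *-monoˡ-≤ (2 ^ k) (*-mono-≤ n≤L[1+e] n≤L[1+e]) ⟩
        L * suc e * (L * suc e) * 2 ^ k      <⟨ *-monoˡ-< (2 ^ k) {{m^n≢0 2 k}} (proj₂ (exp-beats-square L) e e₀≤e) ⟩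
        2 ^ e * 2 ^ k                        ≡⟨ ^-distribˡ-+-* 2 e k ⟨
        2 ^ (e + k)                          ≡⟨ cong (2 ^_) (trans (+-comm e k) k+e≡j) ⟩
        2 ^ j                                ∎
        where open ≤-Reasoning

      gap : (2 * n ∸ g) ^ r * (n * n * 2 ^ k) < (2 * n) ^ r
      gap = subst (λ x → (2 * n ∸ g) ^ r * (n * n * 2 ^ k) < x ^ r) (m∸n+n≡m (<⇒≤ g<2n))
        (z^r*N<[z+g]^r {M = M} {j = j} (m<n⇒0<n∸m g<2n) (≤-trans (m∸n≤m (2 * n) g) 2n≤Mg) jM≤r n²2ᵏ<2ʲ)

    module Construction {n : ℕ} (n₀≤n : n₀ ≤ n) (E : Digraph n) (oriented : IsOriented E)
      (σ₂ : ∀ u v → ¬ u ≡ v → adj E u v ≡ false → suc a * n ≤ a * (deg E u + deg E v))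
      (X : Subset n) (X-small : 2 * a * ∣ X ∣ ≤ n) where

      open Sizes n₀≤n

      linkable : Fin n → Fin n → Bool
      linkable u v = not (does (u ≟ v)) ∧ not (adj E u v)

      linkable-intro : ∀ {u v} → ¬ u ≡ v → adj E u v ≡ false → linkable u v ≡ true
      linkable-intro {u} {v} u≢v nonadj with u ≟ v
      ... | yes u≡v = contradiction u≡v u≢v
      ... | no _    rewrite nonadj = refl

      linkable-elim : ∀ {u v} → linkable u v ≡ true → ¬ u ≡ v × adj E u v ≡ false
      linkable-elim {u} {v} l with u ≟ v | adj E u v
      ... | no u≢v | false = u≢v , refl

      outside-X : Fin n → Bool
      outside-X w = not (lookup X w)

      -- Pairs that need no path get every vertex outside X, so that the whole family is large.
      candidates : Fin n → Fin n → Fin n → Bool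
      candidates u v w = (not (linkable u v) ∨ (adj E u w ∧ adj E v w)) ∧ outside-X w

      candidates⊆outside-X : ∀ u v w → candidates u v w ≡ true → outside-X w ≡ true
      candidates⊆outside-X u v w = ∧-conicalʳ _ (outside-X w)

      candidate⇒common-neighbour : ∀ {u v w} → linkable u v ≡ true → candidates u v w ≡ true →
        adj E u w ≡ true × adj E v w ≡ true
      candidate⇒common-neighbour {u} {v} {w} l c rewrite l with ∧-conicalˡ _ (outside-X w) c
      ... | both = ∧-conicalˡ (adj E u w) (adj E v w) both , ∧-conicalʳ (adj E u w) (adj E v w) both

      candidates-large : ∀ u v → n ≤ 2 * a * count (candidates u v)
      candidates-large u v = +-cancelʳ-≤ n n _ (begin
        n + n                                        ≡⟨ cong (n +_) (+-identityʳ n) ⟨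
        2 * n                                        ≤⟨ *-monoʳ-≤ 2 n≤a|P| ⟩
        2 * (a * count P)                            ≡⟨ *-assoc 2 a (count P) ⟨
        2 * a * count P                              ≤⟨ *-monoʳ-≤ (2 * a) (count-∖ P (lookup X)) ⟩
        2 * a * (count (candidates u v) + count (lookup X))
          ≡⟨ *-distribˡ-+ (2 * a) (count (candidates u v)) (count (lookup X)) ⟩
        2 * a * count (candidates u v) + 2 * a * count (lookup X)
          ≡⟨ cong (λ c → 2 * a * count (candidates u v) + 2 * a * c) (∣p∣≡count X) ⟨
        2 * a * count (candidates u v) + 2 * a * ∣ X ∣  ≤⟨ +-monoʳ-≤ _ X-small ⟩
        2 * a * count (candidates u v) + n           ∎)
        where
        open ≤-Reasoning
        P : Fin n → Bool
        P w = not (linkable u v) ∨ (adj E u w ∧ adj E v w)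
        n≤a|P| : n ≤ a * count P
        n≤a|P| with linkable u v in l
        ... | true  = common-neighbours E oriented a u v (uncurry (σ₂ u v) (linkable-elim l))
        ... | false = ≤-trans (m≤n*m n a) (*-monoʳ-≤ a (≤-reflexive (sym (trans (∑-const n 1) (*-identityʳ n)))))

      family : Fin (n * n) → Fin n → Bool
      family i = uncurry candidates (remQuot n i)

      family-combine : ∀ u v w → family (combine u v) w ≡ candidates u v w
      family-combine u v w = cong (λ uv → uncurry candidates uv w) (remQuot-combine u v)

      family⊆outside-X : ∀ i w → family i w ≡ true → outside-X w ≡ true
      family⊆outside-X i = uncurry candidates⊆outside-X (remQuot n i)

      family-large : ∀ i → g + r ≤ count (family i)
      family-large i = g+r≤ (uncurry candidates-large (remQuot n i))

      r≤|outside-X| : r ≤ count outside-X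
      r≤|outside-X| = ≤-trans (m≤n+m r g) (≤-trans (family-large i₀) (count-mono (family⊆outside-X i₀)))
        where
        i₀ : Fin (n * n)
        i₀ = combine u₀ u₀
          where u₀ = fromℕ< (≤-trans (s≤s z≤n) n₀≤n)

      open HittingSet.Greedy outside-X family family⊆outside-X g r family-large r≤|outside-X|
        using (hits; hitting-set)

      greedy-set : ∃ λ R → (∀ w → R w ≡ true → outside-X w ≡ true) × count R ≡ r × (∀ i → k < hits R i)
      greedy-set = hitting-set k gap

      R : Fin n → Bool
      R = proj₁ greedy-set

      R∩X=∅ : ∀ {w} → w ∈ tabulate R → w ∉ X
      R∩X=∅ {w} w∈R = lookup≡false⇒∉ (not-injective (proj₁ (proj₂ greedy-set) w (∈-tabulate⁻ w∈R)))

      |R|-small : ∣ tabulate R ∣ * (64 * q) ≤ t * n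
      |R|-small = subst (λ c → c * (64 * q) ≤ t * n) (sym (trans (∣tabulate∣≡count R) (proj₁ (proj₂ (proj₂ greedy-set)))))
        (m/n*n≤m (t * n) (64 * q))

      linked : ∀ S → ∣ S ∣ * (2048 * (q * q)) ≤ t * t * n → ∀ u v → ¬ u ≡ v → adj E u v ≡ false →
        ∃ λ w → w ∈ tabulate R × w ∉ S × adj E u w ≡ true × adj E w v ≡ true
      linked S S-small u v u≢v nonadj =
        w , ∈-tabulate⁺ (∧-conicalˡ (R w) _ R∧C) , lookup≡false⇒∉ S[w] ,
        proj₁ uw∧vw , trans (∨-comm (E w v) (E v w)) (proj₂ uw∧vw)
        where
        |S|<hits : count (lookup S) < hits R (combine u v)
        |S|<hits = ≤-<-trans (subst (_≤ k) (∣p∣≡count S) (m*n≤o⇒m≤o/n _ _ _ S-small))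
                             (proj₂ (proj₂ (proj₂ greedy-set)) (combine u v))
        witness : ∃ λ w → (R w ∧ family (combine u v) w) ≡ true × lookup S w ≡ false
        witness = count-<⇒∃ (lookup S) (λ w → R w ∧ family (combine u v) w) |S|<hits
        w : Fin n
        w = proj₁ witness
        R∧C : (R w ∧ family (combine u v) w) ≡ true
        R∧C = proj₁ (proj₂ witness)
        S[w] : lookup S w ≡ false
        S[w] = proj₂ (proj₂ witness)
        uw∧vw : adj E u w ≡ true × adj E v w ≡ true
        uw∧vw = candidate⇒common-neighbour (linkable-intro u≢v nonadj)
          (trans (sym (family-combine u v w)) (∧-conicalʳ (R w) _ R∧C))

    reservoir : ∀ {n} → n₀ ≤ n → ∀ (E : Digraph n) → IsOriented E →
      (∀ u v → ¬ u ≡ v → adj E u v ≡ false → suc a * n ≤ a * (deg E u + deg E v)) →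
      ∀ (X : Subset n) → 2 * a * ∣ X ∣ ≤ n →
      Σ (Subset n) λ R → (∀ {w} → w ∈ R → w ∉ X) × ∣ R ∣ * (64 * q) ≤ t * n ×
        (∀ (S : Subset n) → ∣ S ∣ * (2048 * (q * q)) ≤ t * t * n →
          ∀ u v → ¬ u ≡ v → adj E u v ≡ false →
          ∃ λ w → w ∈ R × w ∉ S × adj E u w ≡ true × adj E w v ≡ true)
    reservoir n₀≤n E oriented σ₂ X X-small = tabulate R , R∩X=∅ , |R|-small , linked
      where open Construction n₀≤n E oriented σ₂ X X-small

open import Defs
open import Data.Nat using (ℕ; _+_)
open import Data.Bool using (Bool; true; false)
open import Data.Fin using (Fin)
open import Data.Fin.Subset using (Subset; _∈_; _∉_; _⊆_; ∣_∣)
open import Data.Rational using (ℚ; 0ℚ; 1ℚ; _≤_; _<_; _*_; _/_) renaming (_+_ to _+ℚ_)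
open import Data.Integer using (+_)
open import Data.Product using (Σ; ∃; _×_; _,_)
open import Relation.Nullary using (¬_)
open import Relation.Binary.PropositionalEquality using (_≡_)

import Data.Nat as ℕ
import Data.Rational as ℚ
open Fractions

lemma4p7 :
    Σ ℚ λ η₀ → 0ℚ < η₀ × (∀ (η : ℚ) → 0ℚ < η → η ≤ η₀ →
    Σ ℚ λ μ₀ → 0ℚ < μ₀ × (∀ (μ : ℚ) → 0ℚ < μ → μ ≤ μ₀ →
    Σ ℚ λ τ₀ → 0ℚ < τ₀ × (∀ (τ : ℚ) → 0ℚ < τ → τ ≤ τ₀ →
    Σ ℕ λ n₀ → ∀ (n : ℕ) → n₀ Data.Nat.≤ n →
    ∀ (E : Digraph n) → IsOriented E →
    (∀ (x y : Fin n) → ¬ (x ≡ y) → adj E x y ≡ false →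
      (1ℚ +ℚ η) * toℚ n ≤ toℚ (deg E x + deg E y)) →
    ∀ (X : Subset n) → toℚ ∣ X ∣ * toℚ ∣ X ∣ ≤ toℚ 64 * μ * (toℚ n * toℚ n) →
    Σ (Subset n) λ R →
      (∀ {w} → w ∈ R → w ∉ X) ×
      toℚ ∣ R ∣ ≤ (+ 1 / 64) * τ * toℚ n ×
      (∀ (S : Subset n) → S ⊆ R →
        toℚ ∣ S ∣ ≤ (+ 1 / 2048) * (τ * τ) * toℚ n →
        ∀ (u v : Fin n) → u ∉ R → v ∉ R → ¬ (u ≡ v) → adj E u v ≡ false →
        ∃ λ (w : Fin n) → w ∈ R × w ∉ S × adj E u w ≡ true × adj E w v ≡ true))))
lemma4p7 = 1ℚ , 0<1/ 1 , λ η η>0 _ →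
  let (_ , η≃) = positive-≃ η η>0
      b = ℚ.denominator-1 η
      a = ℕ.suc b
  in  + 1 / (256 ℕ.* a ℕ.* a) , 0<1/ (256 ℕ.* a ℕ.* a) , λ μ μ>0 μ≤μ₀ →
      + 1 / (32 ℕ.* a) , 0<1/ (32 ℕ.* a) , λ τ τ>0 τ≤τ₀ →
  let (_ , μ≃) = positive-≃ μ μ>0
      (T , τ≃) = positive-≃ τ τ>0
      open Reservoir.Parameters b T (ℚ.denominator-1 τ) (τ≤1/32a⇒32aT≤q τ≃ b τ≤τ₀) using (n₀; reservoir)
  in  n₀ , λ n n₀≤n E oriented σ₂ X X-small →
  let (R , R∩X=∅ , |R|-small , linked) = reservoir n₀≤n E oriented
        (λ u v u≢v nonadj → [1+η]n≤d⇒[1+a]n≤ad η≃ n _ (σ₂ u v u≢v nonadj))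
        X (x²≤64μn²⇒2ax≤n {b = b} μ≃ μ≤μ₀ ∣ X ∣ n X-small)
  in  R , R∩X=∅ , 64qr≤Tn⇒r≤τn/64 τ≃ ∣ R ∣ n |R|-small ,
      λ S _ S-small u v _ _ → linked S (s≤τ²n/2048⇒2048q²s≤T²n τ≃ ∣ S ∣ n S-small) u v
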